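{- Let $\Gamma$ be a distance-regular graph with diameter $D\ge3$, valency $k$ and $a_1\ne0$. Let $\sigma_0,\dots,\sigma_D$ be a nontrivial pseudo cosine sequence that is tight, with auxiliary parameter $\varepsilon$, and write $\sigma=\sigma_1$. Then $\sigma\ne1$, $(\sigma^2-\sigma_2)(1-\varepsilon\sigma)\ne0$, and $$k=h\,\frac{\sigma-\varepsilon}{\sigma-1},\qquad\text{where}\qquad h=\frac{(1-\sigma)(1-\sigma_2)}{(\sigma^2-\sigma_2)(1-\varepsilon\sigma)}.$$
   Context: $\Gamma$ is a finite, undirected, connected graph without loops or multiple edges, with path-length distance $\partial$ and diameter $D$. It is distance-regular: for all $0\le h,i,j\le D$ and all vertices $x,y$ with $\partial(x,y)=h$, the number $p^h_{ij}$ of vertices $z$ with $\partial(x,z)=i$, $\partial(y,z)=j$ depends only on $h,i,j$. Write $a_i=p^i_{1i}$, $b_i=p^i_{1,i+1}$ $(0\le i\le D-1)$, $c_i=p^i_{1,i-1}$ $(1\le i\le D)$, $c_0=0$, $b_D=0$, $k=b_0$. A pseudo cosine sequence (for $\theta\in\mathbb{R}$) is a sequence of reals $\sigma_0,\dots,\sigma_D$ with $\sigma_0=1$ and $c_i\sigma_{i-1}+a_i\sigma_i+b_i\sigma_{i+1}=\theta\sigma_i$ for $0\le i\le D-1$ (with $c_0\sigma_{ -1}=0$). It is trivial if it is the one for $\theta=k$ (all entries $1$), nontrivial otherwise. Two pseudo cosine sequences $\sigma_i,\rho_i$ form a tight pair if $\sigma_0\rho_0,\dots,\sigma_D\rho_D$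 is a pseudo cosine sequence. A nontrivial pseudo cosine sequence $\sigma_0,\dots,\sigma_D$ is tight if there is a nontrivial pseudo cosine sequence $\rho_0,\dots,\rho_D$ forming a tight pair with it; $\varepsilon\in\mathbb{R}$ is its auxiliary parameter if for such $\rho$, $\sigma_i\rho_i-\sigma_{i-1}\rho_{i-1}=\varepsilon(\sigma_{i-1}\rho_i-\sigma_i\rho_{i-1})$ for $1\le i\le D$. -}

module Defs where

open import Level using (0ℓ)
open import Data.Bool using (Bool; true; false; _∧_; _∨_; not; if_then_else_)
open import Data.Nat as ℕ using (ℕ; zero; suc)
open import Data.Fin using (Fin) renaming (_≟_ to _≟Fin_)
open import Relation.Nullary.Decidable using (⌊_⌋)
open import Data.List using (List; map; upTo)
open import Data.Bool.ListAction using (any)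
open import Data.Nat.ListAction using (sum)
open import Data.List using () renaming (allFin to allFinL)
open import Data.Product using (Σ; ∃; _×_; _,_)
open import Relation.Binary.PropositionalEquality using (_≡_; _≢_)
open import Algebra.Structures using (IsCommutativeRing)
open import Relation.Binary.Structures using (IsStrictTotalOrder)
open import Data.Sum using (_⊎_)

-- The real numbers, axiomatised as a complete ordered field
-- (any two models are isomorphic, so quantifying over all of them
-- is the same as working in ℝ).  Inverse is total with 0⁻¹ = 0,
-- so that a/b is always defined; it is only used where b ≠ 0.

record RealField : Set₁ where
  infixl 6 _+_ _-_
  infixl 7 _*_ _/_
  infix 4 _<_ _≤_
  field
    Carrier : Set
    _+_ _*_ : Carrier → Carrier → Carrier
    -_      : Carrier → Carrier
    0# 1#   : Carrier
    isCommutativeRing : IsCommutativeRing _≡_ _+_ _*_ -_ 0# 1#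
    _⁻¹     : Carrier → Carrier
    ⁻¹-inverse : ∀ x → x ≢ 0# → x * (x ⁻¹) ≡ 1#
    0⁻¹≡0   : 0# ⁻¹ ≡ 0#
    0≢1     : 0# ≢ 1#
    _<_     : Carrier → Carrier → Set
    isStrictTotalOrder : IsStrictTotalOrder _≡_ _<_
    +-mono-< : ∀ {x y} z → x < y → x + z < y + z
    *-pos    : ∀ {x y} → 0# < x → 0# < y → 0# < x * y

  _≤_ : Carrier → Carrier → Set
  x ≤ y = x < y ⊎ x ≡ y

  field
    lub : (P : Carrier → Set) → ∃ P → (∃ λ u → ∀ x → P x → x ≤ u) →
          ∃ λ s → (∀ x → P x → x ≤ s) × (∀ u → (∀ x → P x → x ≤ u) → s ≤ u)

  _-_ : Carrier → Carrier → Carrier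
  x - y = x + (- y)

  _/_ : Carrier → Carrier → Carrier
  x / y = x * (y ⁻¹)

  fromℕ : ℕ → Carrier
  fromℕ zero    = 0#
  fromℕ (suc n) = 1# + fromℕ n

record Graph : Set where
  field
    n     : ℕ
    adj   : Fin n → Fin n → Bool
    sym   : ∀ x y → adj x y ≡ adj y x
    loopless : ∀ x → adj x x ≡ false

module _ (Γ : Graph) where
  open Graph Γ

  vertices : List (Fin n)
  vertices = allFinL n

  eqFin : Fin n → Fin n → Bool
  eqFin x y = ⌊ x ≟Fin y ⌋

  within : ℕ → Fin n → Fin n → Bool
  within zero    x y = eqFin x y
  within (suc m) x y = within m x y ∨ any (λ z → within m x z ∧ adj z y) vertices

  Connected : Set
  Connected = ∀ x y → ∃ λ m → within m x y ≡ true

  -- path-length distance: the least m with a walk of length ≤ m,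
  -- computed as the number of m < n for which there is none
  -- (correct for connected graphs, where distances are < n).
  dist : Fin n → Fin n → ℕ
  dist x y = sum (map (λ m → if within m x y then 0 else 1) (upTo n))

  count : (Fin n → Bool) → ℕ
  count f = sum (map (λ z → if f z then 1 else 0) vertices)

  IsDiameter : ℕ → Set
  IsDiameter D = (∀ x y → dist x y ℕ.≤ D) × (∃ λ x → ∃ λ y → dist x y ≡ D)

  IsIntersectionArray : ℕ → (ℕ → ℕ → ℕ → ℕ) → Set
  IsIntersectionArray D p = ∀ x y i j → i ℕ.≤ D → j ℕ.≤ D →
    count (λ z → (dist x z ℕ.≡ᵇ i) ∧ (dist y z ℕ.≡ᵇ j)) ≡ p (dist x y) i j

module Params (p : ℕ → ℕ → ℕ → ℕ) where
  aₙ bₙ cₙ : ℕ → ℕ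
  aₙ i = p i 1 i
  bₙ i = p i 1 (suc i)
  cₙ zero    = 0
  cₙ (suc i) = p (suc i) 1 i
  kₙ : ℕ
  kₙ = bₙ 0

-- Pseudo cosine sequences (sequences are ℕ → ℝ; only indices ≤ D matter).

module PCS (R : RealField) (D : ℕ) (p : ℕ → ℕ → ℕ → ℕ) where
  open RealField R
  open Params p

  cTerm : (ℕ → Carrier) → ℕ → Carrier
  cTerm σ zero    = 0#
  cTerm σ (suc i) = fromℕ (cₙ (suc i)) * σ i

  IsPseudoCosine : Carrier → (ℕ → Carrier) → Set
  IsPseudoCosine θ σ = (σ 0 ≡ 1#) ×
    (∀ i → i ℕ.< D →
      cTerm σ i + fromℕ (aₙ i) * σ i + fromℕ (bₙ i) * σ (suc i) ≡ θ * σ i)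

  IsNontrivialPCS : Carrier → (ℕ → Carrier) → Set
  IsNontrivialPCS θ σ = IsPseudoCosine θ σ × (θ ≢ fromℕ kₙ)

  _·_ : (ℕ → Carrier) → (ℕ → Carrier) → (ℕ → Carrier)
  (σ · ρ) i = σ i * ρ i

  TightPair : (ℕ → Carrier) → (ℕ → Carrier) → Set
  TightPair σ ρ = (∃ λ θ → IsPseudoCosine θ σ) × (∃ λ θ → IsPseudoCosine θ ρ)
                × (∃ λ θ → IsPseudoCosine θ (σ · ρ))

  IsTight : (ℕ → Carrier) → Set
  IsTight σ = (∃ λ θ → IsNontrivialPCS θ σ) ×
    (∃ λ ρ → (∃ λ θ' → IsNontrivialPCS θ' ρ) × TightPair σ ρ)

  IsAuxiliaryParameter : (ℕ → Carrier) → Carrier → Set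
  IsAuxiliaryParameter σ ε = ∃ λ ρ → (∃ λ θ' → IsNontrivialPCS θ' ρ) × TightPair σ ρ ×
    (∀ i → 1 ℕ.≤ i → i ℕ.≤ D →
      σ i * ρ i - σ (ℕ.pred i) * ρ (ℕ.pred i)
        ≡ ε * (σ (ℕ.pred i) * ρ i - σ i * ρ (ℕ.pred i)))

{-# OPTIONS --safe #-}
-- For a pseudo cosine sequence φ the recurrence at i = 0 gives θ = kφ₁, and at i = 1 (with a₀ = 0,
-- c₁ = 1, k = 1 + a₁ + b₁) it becomes b₁(φ₂ − 1) = (φ₁ − 1)(kφ₁ + 1 + b₁). Writing this for σ, ρ and σρ
-- and eliminating σ₂ρ₂ yields, as σ₁, ρ₁ ≠ 1 and b₁ ≠ 0, the relation kρ₁(σ₁² − σ₂) = σ₂ − 1. The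
-- auxiliary relation at i = 1 reads ρ₁(σ₁ − ε) = 1 − εσ₁, so k(σ₁² − σ₂)(1 − εσ₁) = (σ₂ − 1)(σ₁ − ε),
-- which is the formula for k as soon as (σ₁² − σ₂)(1 − εσ₁) ≠ 0. Each way for this factor to vanish
-- (σ₁² = σ₂, ρ₁ = 0, σ₁ = ε) is pushed, through the recurrences at i = 2 and the auxiliary relations at
-- i = 2, 3, to a contradiction, mostly a vanishing positive combination of a₁, b₁, c₂, a₂, b₂. Their
-- positivity is read off a geodesic x ∼ y ∼ z ∼ v; for a₂ one uses a common neighbour of y and z, which
-- exists since a₁ ≠ 0.

module Submission where

open import Defs
open import Data.Nat using (ℕ; _≤_)
open import Data.Product using (_×_; ∃)
open import Relation.Binary.PropositionalEquality using (_≡_; _≢_)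

open import Relation.Binary.PropositionalEquality using (refl; sym; trans; cong; cong₂; subst; subst₂; module ≡-Reasoning)
open import Algebra.Bundles using (CommutativeRing)
open import Algebra.Solver.Ring.AlmostCommutativeRing using (_-Raw-AlmostCommutative⟶_; fromCommutativeRing)
open import Data.Bool using (Bool; true; false; T; _∧_; if_then_else_)
open import Data.Bool.Properties using (T-∨; T-∧)
open import Data.Empty using (⊥-elim)
open import Data.Fin using (Fin) renaming (zero to fzero; suc to fsuc)
import Data.Fin.Properties as Fin
import Data.Integer as ℤ
import Data.Integer.Properties as ℤ
import Data.Nat as ℕ
import Data.Nat.Properties as ℕ
open import Data.List using (List; []; _∷_; map; tabulate; allFin; applyUpTo)
open import Data.List.Properties using (map-tabulate; map-applyUpTo)
open import Data.List.Relation.Unary.Any using (Any; here; there; satisfied)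
open import Data.List.Relation.Unary.Any.Properties using (any⁺; any⁻; tabulate⁺)
open import Data.Maybe using (Maybe; just; nothing)
open import Data.Nat using (zero; suc; z≤n; s≤s)
open import Data.Nat.ListAction using (sum)
open import Data.Nat.Properties using (≡ᵇ⇒≡; ≡⇒≡ᵇ)
open import Data.Product using (_,_; proj₁; proj₂)
import Data.Sign as Sign
open import Data.Sum using (_⊎_; inj₁; inj₂; [_,_]′)
open import Function using (_∘_; id; case_of_)
open import Function.Bundles using (Equivalence)
open import Level using (0ℓ)
open import Relation.Binary.Definitions using (tri<; tri≈; tri>)
import Relation.Binary.PropositionalEquality as ≡
open import Relation.Binary.Structures using (IsStrictTotalOrder)
open import Relation.Nullary using (¬_; yes; no)
open import Relation.Nullary.Decidable using (toWitness; fromWitness)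

-- Algebra.Solver.Ring can only cancel terms whose coefficients it can compare, so it needs a coefficient
-- ring with decidable equality; ℤ, which maps into every commutative ring, serves.
module IntegerCoefficients {c ℓ} (R : CommutativeRing c ℓ) where
  open import Data.Integer using (ℤ; +_; -[1+_])
  open CommutativeRing R renaming (refl to ≈-refl; sym to ≈-sym; trans to ≈-trans; reflexive to ≈-reflexive)
  open import Algebra.Properties.Semiring.Mult.TCOptimised semiring using (×-homo-+; ×1-homo-*) renaming (_×_ to _×′_)
  open import Algebra.Properties.Ring ring using (-‿distribˡ-*; -1*x≈-x)
  open import Algebra.Properties.AbelianGroup +-abelianGroup using (⁻¹-∙-comm)
  open import Algebra.Properties.Group +-group using (ε⁻¹≈ε; ⁻¹-involutive)
  open import Algebra.Properties.CommutativeSemigroup +-commutativeSemigroup using () renaming (interchange to +-interchange)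
  open import Algebra.Properties.CommutativeSemigroup *-commutativeSemigroup using () renaming (interchange to *-interchange)
  open import Relation.Binary.Reasoning.Setoid setoid

  ⟦_⟧ℤ : ℤ → Carrier
  ⟦ + n ⟧ℤ = n ×′ 1#
  ⟦ -[1+ n ] ⟧ℤ = - (suc n ×′ 1#)

  suc×1 : ∀ n → suc n ×′ 1# ≈ 1# + n ×′ 1#
  suc×1 n = ×-homo-+ 1# 1 n

  +-cancelˡ-- : ∀ z x y → (z + x) - (z + y) ≈ x - y
  +-cancelˡ-- z x y = begin
    (z + x) - (z + y)         ≈⟨ +-congˡ (⁻¹-∙-comm z y) ⟨
    (z + x) + (- z + - y)     ≈⟨ +-interchange z x (- z) (- y) ⟩
    (z - z) + (x - y)         ≈⟨ +-congʳ (-‿inverseʳ z) ⟩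
    0# + (x - y)              ≈⟨ +-identityˡ (x - y) ⟩
    x - y                     ∎

  ⊖-homo : ∀ m n → ⟦ m ℤ.⊖ n ⟧ℤ ≈ m ×′ 1# - n ×′ 1#
  ⊖-homo m zero = begin
    m ×′ 1#        ≈⟨ +-identityʳ (m ×′ 1#) ⟨
    m ×′ 1# + 0#   ≈⟨ +-congˡ ε⁻¹≈ε ⟨
    m ×′ 1# - 0#   ∎
  ⊖-homo zero (suc n) = ≈-sym (+-identityˡ _)
  ⊖-homo (suc m) (suc n) = begin
    ⟦ suc m ℤ.⊖ suc n ⟧ℤ              ≡⟨ ≡.cong ⟦_⟧ℤ (ℤ.[1+m]⊖[1+n]≡m⊖n m n) ⟩
    ⟦ m ℤ.⊖ n ⟧ℤ                      ≈⟨ ⊖-homo m n ⟩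
    m ×′ 1# - n ×′ 1#                   ≈⟨ +-cancelˡ-- 1# (m ×′ 1#) (n ×′ 1#) ⟨
    (1# + m ×′ 1#) - (1# + n ×′ 1#)     ≈⟨ +-cong (suc×1 m) (-‿cong (suc×1 n)) ⟨
    suc m ×′ 1# - suc n ×′ 1#           ∎

  +-homo : ∀ i j → ⟦ i ℤ.+ j ⟧ℤ ≈ ⟦ i ⟧ℤ + ⟦ j ⟧ℤ
  +-homo (+ m) (+ n) = ×-homo-+ 1# m n
  +-homo (+ m) -[1+ n ] = ⊖-homo m (suc n)
  +-homo -[1+ m ] (+ n) = ≈-trans (⊖-homo n (suc m)) (+-comm _ _)
  +-homo -[1+ m ] -[1+ n ] = begin
    - (suc (suc (m ℕ.+ n)) ×′ 1#)              ≡⟨ ≡.cong (λ k → - (suc k ×′ 1#)) (ℕ.+-suc m n) ⟨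
    - ((suc m ℕ.+ suc n) ×′ 1#)                ≈⟨ -‿cong (×-homo-+ 1# (suc m) (suc n)) ⟩
    - (suc m ×′ 1# + suc n ×′ 1#)               ≈⟨ ⁻¹-∙-comm _ _ ⟨
    - (suc m ×′ 1#) + - (suc n ×′ 1#)           ∎

  -‿homo : ∀ i → ⟦ ℤ.- i ⟧ℤ ≈ - ⟦ i ⟧ℤ
  -‿homo (+ zero) = ≈-sym ε⁻¹≈ε
  -‿homo (+ suc n) = ≈-refl
  -‿homo -[1+ n ] = ≈-sym (⁻¹-involutive _)

  ⟦_⟧± : Sign.Sign → Carrier
  ⟦ Sign.+ ⟧± = 1#
  ⟦ Sign.- ⟧± = - 1#

  ◃-homo : ∀ s n → ⟦ s ℤ.◃ n ⟧ℤ ≈ ⟦ s ⟧± * (n ×′ 1#)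
  ◃-homo s zero = ≈-sym (zeroʳ _)
  ◃-homo Sign.+ (suc n) = ≈-sym (*-identityˡ _)
  ◃-homo Sign.- (suc n) = ≈-sym (-1*x≈-x _)

  sign-abs : ∀ i → ⟦ i ⟧ℤ ≈ ⟦ ℤ.sign i ⟧± * (ℤ.∣ i ∣ ×′ 1#)
  sign-abs i = ≈-trans (≈-reflexive (≡.cong ⟦_⟧ℤ (≡.sym (ℤ.◃-inverse i)))) (◃-homo (ℤ.sign i) ℤ.∣ i ∣)

  sign-*-homo : ∀ s t → ⟦ s Sign.* t ⟧± ≈ ⟦ s ⟧± * ⟦ t ⟧±
  sign-*-homo Sign.+ t = ≈-sym (*-identityˡ _)
  sign-*-homo Sign.- Sign.+ = ≈-sym (*-identityʳ _)
  sign-*-homo Sign.- Sign.- = ≈-sym (≈-trans (-1*x≈-x _) (⁻¹-involutive _))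

  *-homo : ∀ i j → ⟦ i ℤ.* j ⟧ℤ ≈ ⟦ i ⟧ℤ * ⟦ j ⟧ℤ
  *-homo i j = begin
    ⟦ s Sign.* t ℤ.◃ ∣i∣ ℕ.* ∣j∣ ⟧ℤ               ≈⟨ ◃-homo (s Sign.* t) (∣i∣ ℕ.* ∣j∣) ⟩
    ⟦ s Sign.* t ⟧± * ((∣i∣ ℕ.* ∣j∣) ×′ 1#)          ≈⟨ *-cong (sign-*-homo s t) (×1-homo-* ∣i∣ ∣j∣) ⟩
    (⟦ s ⟧± * ⟦ t ⟧±) * (∣i∣ ×′ 1# * ∣j∣ ×′ 1#)      ≈⟨ *-interchange _ _ _ _ ⟩
    (⟦ s ⟧± * ∣i∣ ×′ 1#) * (⟦ t ⟧± * ∣j∣ ×′ 1#)      ≈⟨ *-cong (sign-abs i) (sign-abs j) ⟨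
    ⟦ i ⟧ℤ * ⟦ j ⟧ℤ                                ∎
    where
    s = ℤ.sign i
    t = ℤ.sign j
    ∣i∣ = ℤ.∣ i ∣
    ∣j∣ = ℤ.∣ j ∣

  homomorphism : ℤ.+-*-rawRing -Raw-AlmostCommutative⟶ fromCommutativeRing R
  homomorphism = record
    { ⟦_⟧ = ⟦_⟧ℤ ; +-homo = +-homo ; *-homo = *-homo ; -‿homo = -‿homo ; 0-homo = ≈-refl ; 1-homo = ≈-refl }

  coefficient≟ : ∀ i j → Maybe (⟦ i ⟧ℤ ≈ ⟦ j ⟧ℤ)
  coefficient≟ i j with i ℤ.≟ j
  ... | yes ≡.refl = just ≈-refl
  ... | no _ = nothing

  open import Algebra.Solver.Ring ℤ.+-*-rawRing (fromCommutativeRing R) homomorphism coefficient≟ public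

module RealFieldProperties (R : RealField) where
  open RealField R

  commutativeRing : CommutativeRing 0ℓ 0ℓ
  commutativeRing = record { isCommutativeRing = isCommutativeRing }

  open CommutativeRing commutativeRing public
    using (+-assoc; +-identityˡ; +-identityʳ; -‿inverseʳ; *-assoc; *-comm; *-identityˡ; *-identityʳ; zeroˡ; zeroʳ)
  open CommutativeRing commutativeRing using (+-group; ring)
  open import Algebra.Properties.Group +-group using (x∙y⁻¹≈ε⇒x≈y; ⁻¹-involutive)
  open import Algebra.Properties.Ring ring using (-1*x≈-x)
  open IntegerCoefficients commutativeRing public using (Polynomial; con; solve; _:=_; _:+_; _:*_; _:-_; :-_)
  open IsStrictTotalOrder isStrictTotalOrder using (_≟_; compare; irrefl) renaming (trans to <-trans)

  𝟎 𝟏 : ∀ {m} → Polynomial m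
  𝟎 = con (ℤ.+ 0)
  𝟏 = con (ℤ.+ 1)

  sub≡0⇒≡ : ∀ {x y} → x - y ≡ 0# → x ≡ y
  sub≡0⇒≡ = x∙y⁻¹≈ε⇒x≈y _ _

  -≢0 : ∀ {x y} → x ≢ y → x - y ≢ 0#
  -≢0 x≢y = x≢y ∘ sub≡0⇒≡

  zero-combination : ∀ c l → c * (l - l) ≡ 0#
  zero-combination c l = trans (cong (c *_) (-‿inverseʳ l)) (zeroʳ c)

  combine₁ : ∀ {x y c l r} → x - y ≡ c * (l - r) → l ≡ r → x ≡ y
  combine₁ {c = c} {l} eq refl = sub≡0⇒≡ (trans eq (zero-combination c l))

  combine₂ : ∀ {x y c₁ l₁ r₁ c₂ l₂ r₂} → x - y ≡ c₁ * (l₁ - r₁) + c₂ * (l₂ - r₂) →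
             l₁ ≡ r₁ → l₂ ≡ r₂ → x ≡ y
  combine₂ {c₁ = c₁} {l₁} {c₂ = c₂} {l₂} eq refl refl = sub≡0⇒≡ (begin
    _                                 ≡⟨ eq ⟩
    c₁ * (l₁ - l₁) + c₂ * (l₂ - l₂)   ≡⟨ cong₂ _+_ (zero-combination c₁ l₁) (zero-combination c₂ l₂) ⟩
    0# + 0#                           ≡⟨ +-identityʳ 0# ⟩
    0#                                ∎)
    where open ≡-Reasoning

  combine₃ : ∀ {x y c₁ l₁ r₁ c₂ l₂ r₂ c₃ l₃ r₃} →
             x - y ≡ c₁ * (l₁ - r₁) + c₂ * (l₂ - r₂) + c₃ * (l₃ - r₃) →
             l₁ ≡ r₁ → l₂ ≡ r₂ → l₃ ≡ r₃ → x ≡ y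
  combine₃ {c₁ = c₁} {l₁} {r₁} {c₂} {l₂} {r₂} {c₃} {l₃} eq h₁ h₂ refl = combine₂ (begin
    _                                                  ≡⟨ eq ⟩
    c₁ * (l₁ - r₁) + c₂ * (l₂ - r₂) + c₃ * (l₃ - l₃)   ≡⟨ cong (c₁ * (l₁ - r₁) + c₂ * (l₂ - r₂) +_) (zero-combination c₃ l₃) ⟩
    c₁ * (l₁ - r₁) + c₂ * (l₂ - r₂) + 0#               ≡⟨ +-identityʳ _ ⟩
    c₁ * (l₁ - r₁) + c₂ * (l₂ - r₂)                    ∎) h₁ h₂
    where open ≡-Reasoning

  combine₄ : ∀ {x y c₁ l₁ r₁ c₂ l₂ r₂ c₃ l₃ r₃ c₄ l₄ r₄} →
             x - y ≡ c₁ * (l₁ - r₁) + c₂ * (l₂ - r₂) + c₃ * (l₃ - r₃) + c₄ * (l₄ - r₄) →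
             l₁ ≡ r₁ → l₂ ≡ r₂ → l₃ ≡ r₃ → l₄ ≡ r₄ → x ≡ y
  combine₄ {c₁ = c₁} {l₁} {r₁} {c₂} {l₂} {r₂} {c₃} {l₃} {r₃} {c₄} {l₄} eq h₁ h₂ h₃ refl = combine₃ (begin
    _                                                     ≡⟨ eq ⟩
    c₁ * (l₁ - r₁) + c₂ * (l₂ - r₂) + c₃ * (l₃ - r₃) + c₄ * (l₄ - l₄)
      ≡⟨ cong (c₁ * (l₁ - r₁) + c₂ * (l₂ - r₂) + c₃ * (l₃ - r₃) +_) (zero-combination c₄ l₄) ⟩
    c₁ * (l₁ - r₁) + c₂ * (l₂ - r₂) + c₃ * (l₃ - r₃) + 0#  ≡⟨ +-identityʳ _ ⟩
    c₁ * (l₁ - r₁) + c₂ * (l₂ - r₂) + c₃ * (l₃ - r₃)       ∎) h₁ h₂ h₃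
    where open ≡-Reasoning

  *-cancelˡ-≡0 : ∀ {x y} → x ≢ 0# → x * y ≡ 0# → y ≡ 0#
  *-cancelˡ-≡0 {x} {y} x≢0 xy≡0 = begin
    y                 ≡⟨ *-identityˡ y ⟨
    1# * y            ≡⟨ cong (_* y) (trans (*-comm (x ⁻¹) x) (⁻¹-inverse x x≢0)) ⟨
    (x ⁻¹ * x) * y    ≡⟨ *-assoc _ _ _ ⟩
    x ⁻¹ * (x * y)    ≡⟨ cong (x ⁻¹ *_) xy≡0 ⟩
    x ⁻¹ * 0#         ≡⟨ zeroʳ _ ⟩
    0#                ∎
    where open ≡-Reasoning

  *≡0⇒ : ∀ {x y} → x * y ≡ 0# → x ≡ 0# ⊎ y ≡ 0#
  *≡0⇒ {x} xy≡0 with x ≟ 0#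
  ... | yes x≡0 = inj₁ x≡0
  ... | no x≢0 = inj₂ (*-cancelˡ-≡0 x≢0 xy≡0)

  *-≢0 : ∀ {x y} → x ≢ 0# → y ≢ 0# → x * y ≢ 0#
  *-≢0 x≢0 y≢0 xy≡0 = [ x≢0 , y≢0 ]′ (*≡0⇒ xy≡0)

  x*x≡1⇒x≡-1 : ∀ {x} → x * x ≡ 1# → x ≢ 1# → x ≡ - 1#
  x*x≡1⇒x≡-1 {x} x²≡1 x≢1 = sub≡0⇒≡ (*-cancelˡ-≡0 (-≢0 x≢1)
    (combine₁ (solve 1 (λ x → (x :- 𝟏) :* (x :- :- 𝟏) :- 𝟎 := 𝟏 :* (x :* x :- 𝟏)) refl x) x²≡1))

  *≡*⇒≡/*/ : ∀ {x y z w c} → y ≢ 0# → w ≢ 0# → x * z ≡ c * (y * w) → c ≡ x / y * (z / w)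
  *≡*⇒≡/*/ {x} {y} {z} {w} {c} y≢0 w≢0 xz≡cyw = sym (begin
    x / y * (z / w)                ≡⟨ solve 4 (λ x z y⁻¹ w⁻¹ → x :* y⁻¹ :* (z :* w⁻¹) := x :* z :* (y⁻¹ :* w⁻¹))
                                        refl x z (y ⁻¹) (w ⁻¹) ⟩
    x * z * (y ⁻¹ * w ⁻¹)          ≡⟨ cong (_* (y ⁻¹ * w ⁻¹)) xz≡cyw ⟩
    c * (y * w) * (y ⁻¹ * w ⁻¹)    ≡⟨ solve 5 (λ c y w y⁻¹ w⁻¹ → c :* (y :* w) :* (y⁻¹ :* w⁻¹) := c :* (y :* y⁻¹) :* (w :* w⁻¹))
                                        refl c y w (y ⁻¹) (w ⁻¹) ⟩
    c * (y * y ⁻¹) * (w * w ⁻¹)    ≡⟨ cong₂ (λ u v → c * u * v) (⁻¹-inverse y y≢0) (⁻¹-inverse w w≢0) ⟩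
    c * 1# * 1#                    ≡⟨ trans (*-identityʳ _) (*-identityʳ c) ⟩
    c                              ∎)
    where open ≡-Reasoning

  0<⇒≢0 : ∀ {x} → 0# < x → x ≢ 0#
  0<⇒≢0 0<x x≡0 = irrefl (sym x≡0) 0<x

  0<1 : 0# < 1#
  0<1 with compare 0# 1#
  ... | tri< 0<1 _ _ = 0<1
  ... | tri≈ _ 0≡1 _ = ⊥-elim (0≢1 0≡1)
  ... | tri> _ _ 1<0 = ⊥-elim (irrefl refl (<-trans 1<0 (subst (0# <_) -1*-1≡1 (*-pos 0<-1 0<-1))))
    where
    0<-1 : 0# < - 1#
    0<-1 = subst₂ _<_ (-‿inverseʳ 1#) (+-identityˡ (- 1#)) (+-mono-< (- 1#) 1<0)
    -1*-1≡1 : - 1# * - 1# ≡ 1#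
    -1*-1≡1 = trans (-1*x≈-x (- 1#)) (⁻¹-involutive 1#)

  +-pos : ∀ {x y} → 0# < x → 0# < y → 0# < x + y
  +-pos {x} {y} 0<x 0<y = <-trans 0<y (subst (_< x + y) (+-identityˡ y) (+-mono-< y 0<x))

  0<fromℕ : ∀ {n} → n ≢ 0 → 0# < fromℕ n
  0<fromℕ {zero} n≢0 = ⊥-elim (n≢0 refl)
  0<fromℕ {suc zero} _ = subst (0# <_) (sym (+-identityʳ 1#)) 0<1
  0<fromℕ {suc (suc n)} _ = +-pos 0<1 (0<fromℕ {suc n} λ ())

  fromℕ-+ : ∀ m n → fromℕ (m ℕ.+ n) ≡ fromℕ m + fromℕ n
  fromℕ-+ zero n = sym (+-identityˡ _)
  fromℕ-+ (suc m) n = trans (cong (1# +_) (fromℕ-+ m n)) (sym (+-assoc _ _ _))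

module TightPairs (R : RealField) where
  open RealField R
  open RealFieldProperties R

  record Parameters : Set where
    field
      a₁ b₁ c₂ a₂ b₂ : Carrier
      0<a₁ : 0# < a₁
      0<b₁ : 0# < b₁
      0<c₂ : 0# < c₂
      0<a₂ : 0# < a₂
      0<b₂ : 0# < b₂

    k : Carrier
    k = 1# + (a₁ + b₁)

    field
      k≡c₂+a₂+b₂ : k ≡ c₂ + a₂ + b₂

  -- Polynomial forms of k and of lhs − rhs of the recurrences and auxiliary relations, in which the
  -- solver certificates below (x − y = Σ cᵢ (lᵢ − rᵢ), see combine₁…₄) are written.
  kᵖ : ∀ {m} (a b : Polynomial m) → Polynomial m
  kᵖ a b = 𝟏 :+ (a :+ b)

  at₁ᵖ : ∀ {m} (a b φ₁ φ₂ : Polynomial m) → Polynomial m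
  at₁ᵖ a b φ₁ φ₂ = 𝟏 :+ a :* φ₁ :+ b :* φ₂ :- kᵖ a b :* φ₁ :* φ₁

  at₂ᵖ : ∀ {m} (k c₂ a₂ b₂ φ₁ φ₂ φ₃ : Polynomial m) → Polynomial m
  at₂ᵖ k c₂ a₂ b₂ φ₁ φ₂ φ₃ = c₂ :* φ₁ :+ a₂ :* φ₂ :+ b₂ :* φ₃ :- k :* φ₁ :* φ₂

  auxᵖ : ∀ {m} (ε σᵢ ρᵢ σⱼ ρⱼ : Polynomial m) → Polynomial m
  auxᵖ ε σᵢ ρᵢ σⱼ ρⱼ = σⱼ :* ρⱼ :- σᵢ :* ρᵢ :- ε :* (σᵢ :* ρⱼ :- σⱼ :* ρᵢ)

  module _ (P : Parameters) where
    open Parameters P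

    -- The pseudo cosine recurrence at i = 1, 2 once σ₀ = 1, c₁ = 1 and θ = kσ₁ are substituted.
    record Recurrence (φ : ℕ → Carrier) : Set where
      field
        at₁ : 1# + a₁ * φ 1 + b₁ * φ 2 ≡ k * φ 1 * φ 1
        at₂ : c₂ * φ 1 + a₂ * φ 2 + b₂ * φ 3 ≡ k * φ 1 * φ 2

    record TightPair₃ (σ ρ : ℕ → Carrier) (ε : Carrier) : Set where
      field
        σ-rec : Recurrence σ
        ρ-rec : Recurrence ρ
        σρ-rec : Recurrence (λ i → σ i * ρ i)
        σ₁≢1 : σ 1 ≢ 1#
        ρ₁≢1 : ρ 1 ≢ 1#
        aux₁ : σ 1 * ρ 1 - 1# ≡ ε * (ρ 1 - σ 1)
        aux₂ : σ 2 * ρ 2 - σ 1 * ρ 1 ≡ ε * (σ 1 * ρ 2 - σ 2 * ρ 1)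
        aux₃ : σ 3 * ρ 3 - σ 2 * ρ 2 ≡ ε * (σ 2 * ρ 3 - σ 3 * ρ 2)

    module _ {σ ρ ε} (pair : TightPair₃ σ ρ ε) where
      open TightPair₃ pair
      open Recurrence

      private
        σ₁ σ₂ σ₃ ρ₁ ρ₂ ρ₃ : Carrier
        σ₁ = σ 1
        σ₂ = σ 2
        σ₃ = σ 3
        ρ₁ = ρ 1
        ρ₂ = ρ 2
        ρ₃ = ρ 3

      -- Substitute b₁(φ₂ − 1) = (φ₁ − 1)(kφ₁ + 1 + b₁), for φ = σ, ρ, σρ, into
      -- b₁²(σ₂ρ₂ − 1) = b₁²((σ₂ − 1)(ρ₂ − 1) + (σ₂ − 1) + (ρ₂ − 1)) and cancel (σ₁ − 1)(ρ₁ − 1).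
      tight-pair-relation : 1# + b₁ + k * (σ₁ + ρ₁) + k * (1# + a₁) * σ₁ * ρ₁ ≡ 0#
      tight-pair-relation = *-cancelˡ-≡0 (-≢0 ρ₁≢1) (*-cancelˡ-≡0 (-≢0 σ₁≢1)
        (trans (sym (*-assoc _ _ _)) (combine₃ (solve 6 (λ a b s t r u →
          (s :- 𝟏) :* (r :- 𝟏) :* (𝟏 :+ b :+ kᵖ a b :* (s :+ r) :+ kᵖ a b :* (𝟏 :+ a) :* s :* r) :- 𝟎
            := (at₁ᵖ a b r u :- b :* u) :* at₁ᵖ a b s t :+ (:- (b :* t)) :* at₁ᵖ a b r u
               :+ b :* at₁ᵖ a b (s :* r) (t :* u))
          refl a₁ b₁ σ₁ σ₂ ρ₁ ρ₂) (at₁ σ-rec) (at₁ ρ-rec) (at₁ σρ-rec))))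

      ρ₁-relation : k * ρ₁ * (σ₁ * σ₁ - σ₂) ≡ σ₂ - 1#
      ρ₁-relation = sub≡0⇒≡ (*-cancelˡ-≡0 (0<⇒≢0 0<b₁) (combine₂ (solve 5 (λ a b s t r →
          b :* (kᵖ a b :* r :* (s :* s :- t) :- (t :- 𝟏)) :- 𝟎
            := (𝟏 :- s) :* (𝟏 :+ b :+ kᵖ a b :* (s :+ r) :+ kᵖ a b :* (𝟏 :+ a) :* s :* r :- 𝟎)
               :+ (:- (𝟏 :+ r :+ a :* r :+ b :* r)) :* at₁ᵖ a b s t)
          refl a₁ b₁ σ₁ σ₂ ρ₁) tight-pair-relation (at₁ σ-rec)))

      σ₁²≢σ₂ : σ₁ * σ₁ ≢ σ₂
      σ₁²≢σ₂ σ₁²≡σ₂ = 0<⇒≢0 (+-pos 0<a₁ 0<a₁) a₁+a₁≡0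
        where
        σ₂≡1 : σ₂ ≡ 1#
        σ₂≡1 = combine₂ (solve 5 (λ a b s t r →
            t :- 𝟏 := (:- 𝟏) :* (kᵖ a b :* r :* (s :* s :- t) :- (t :- 𝟏)) :+ (kᵖ a b :* r) :* (s :* s :- t))
          refl a₁ b₁ σ₁ σ₂ ρ₁) ρ₁-relation σ₁²≡σ₂
        σ₁≡-1 : σ₁ ≡ - 1#
        σ₁≡-1 = x*x≡1⇒x≡-1 (trans σ₁²≡σ₂ σ₂≡1) σ₁≢1
        a₁+a₁≡0 : a₁ + a₁ ≡ 0#
        a₁+a₁≡0 = combine₃ (solve 4 (λ a b s t →
            a :+ a :- 𝟎
              := (:- 𝟏) :* at₁ᵖ a b s t :+ b :* (t :- 𝟏)
                 :+ ((𝟏 :+ b) :* (𝟏 :- s) :+ a :* (𝟏 :+ 𝟏 :- s)) :* (s :- :- 𝟏))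
          refl a₁ b₁ σ₁ σ₂) (at₁ σ-rec) σ₂≡1 σ₁≡-1

      ρ₁≢0 : ρ₁ ≢ 0#
      ρ₁≢0 ρ₁≡0 = *-≢0 (0<⇒≢0 0<b₂) (*-≢0 ρ₃≢0 (-≢0 (σ₃≢1 ∘ sym))) b₂ρ₃[1-σ₃]≡0
        where
        σ₂≡1 : σ₂ ≡ 1#
        σ₂≡1 = combine₂ (solve 5 (λ a b s t r →
            t :- 𝟏 := (:- 𝟏) :* (kᵖ a b :* r :* (s :* s :- t) :- (t :- 𝟏)) :+ (kᵖ a b :* (s :* s :- t)) :* (r :- 𝟎))
          refl a₁ b₁ σ₁ σ₂ ρ₁) ρ₁-relation ρ₁≡0
        ρ₂≢0 : ρ₂ ≢ 0#
        ρ₂≢0 ρ₂≡0 = 0≢1 (sym (combine₃ (solve 4 (λ a b r u →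
            𝟏 :- 𝟎 := 𝟏 :* at₁ᵖ a b r u :+ (kᵖ a b :* r :- a) :* (r :- 𝟎) :+ (:- b) :* (u :- 𝟎))
          refl a₁ b₁ ρ₁ ρ₂) (at₁ ρ-rec) ρ₁≡0 ρ₂≡0))
        b₂ρ₃[1-σ₃]≡0 : b₂ * (ρ₃ * (1# - σ₃)) ≡ 0#
        b₂ρ₃[1-σ₃]≡0 = combine₄ (solve 11 (λ a b c₂ a₂ b₂ s t s₃ r u r₃ →
            b₂ :* (r₃ :* (𝟏 :- s₃)) :- 𝟎
              := 𝟏 :* at₂ᵖ (kᵖ a b) c₂ a₂ b₂ r u r₃ :+ (:- 𝟏) :* at₂ᵖ (kᵖ a b) c₂ a₂ b₂ (s :* r) (t :* u) (s₃ :* r₃)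
                 :+ (:- (c₂ :* (𝟏 :- s) :- kᵖ a b :* u :+ kᵖ a b :* s :* t :* u)) :* (r :- 𝟎)
                 :+ (a₂ :* u) :* (t :- 𝟏))
          refl a₁ b₁ c₂ a₂ b₂ σ₁ σ₂ σ₃ ρ₁ ρ₂ ρ₃) (at₂ ρ-rec) (at₂ σρ-rec) ρ₁≡0 σ₂≡1
        ρ₃≢0 : ρ₃ ≢ 0#
        ρ₃≢0 ρ₃≡0 = *-≢0 (0<⇒≢0 0<a₂) ρ₂≢0 (combine₃ (solve 8 (λ a b c₂ a₂ b₂ r u r₃ →
            a₂ :* u :- 𝟎
              := 𝟏 :* at₂ᵖ (kᵖ a b) c₂ a₂ b₂ r u r₃ :+ (:- (c₂ :- kᵖ a b :* u)) :* (r :- 𝟎) :+ (:- b₂) :* (r₃ :- 𝟎))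
          refl a₁ b₁ c₂ a₂ b₂ ρ₁ ρ₂ ρ₃) (at₂ ρ-rec) ρ₁≡0 ρ₃≡0)
        σ₃≢1 : σ₃ ≢ 1#
        σ₃≢1 σ₃≡1 = *-≢0 (0<⇒≢0 (+-pos 0<a₂ 0<b₂)) (-≢0 (σ₁≢1 ∘ sym)) (combine₄ (solve 8 (λ a b c₂ a₂ b₂ s t s₃ →
            (a₂ :+ b₂) :* (𝟏 :- s) :- 𝟎
              := 𝟏 :* at₂ᵖ (kᵖ a b) c₂ a₂ b₂ s t s₃ :+ (:- (a₂ :- kᵖ a b :* s)) :* (t :- 𝟏)
                 :+ (:- b₂) :* (s₃ :- 𝟏) :+ s :* (kᵖ a b :- (c₂ :+ a₂ :+ b₂)))
          refl a₁ b₁ c₂ a₂ b₂ σ₁ σ₂ σ₃) (at₂ σ-rec) σ₂≡1 σ₃≡1 k≡c₂+a₂+b₂)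

      σ₁≢ε : σ₁ ≢ ε
      σ₁≢ε σ₁≡ε = *-≢0 σ₃+σ₂≢0 (-≢0 ρ₃≢ρ₂) [σ₃+σ₂][ρ₃-ρ₂]≡0
        where
        σ₁²≡1 : σ₁ * σ₁ ≡ 1#
        σ₁²≡1 = combine₂ (solve 3 (λ s r ε →
            s :* s :- 𝟏 := 𝟏 :* (s :* r :- 𝟏 :- ε :* (r :- s)) :+ (s :- r) :* (s :- ε))
          refl σ₁ ρ₁ ε) aux₁ σ₁≡ε
        σ₁≡-1 : σ₁ ≡ - 1#
        σ₁≡-1 = x*x≡1⇒x≡-1 σ₁²≡1 σ₁≢1
        ε≡-1 : ε ≡ - 1#
        ε≡-1 = trans (sym σ₁≡ε) σ₁≡-1
        ρ₂≡ρ₁ : ρ₂ ≡ ρ₁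
        ρ₂≡ρ₁ = sub≡0⇒≡ (*-cancelˡ-≡0 (-≢0 (σ₁²≢σ₂ ∘ trans σ₁²≡1 ∘ sym)) (combine₃ (solve 5 (λ s t r u ε →
            (t :- 𝟏) :* (u :- r) :- 𝟎
              := 𝟏 :* auxᵖ ε s r t u :+ (ε :* u :+ r) :* (s :- :- 𝟏) :+ (:- (r :* t) :- u) :* (ε :- :- 𝟏))
          refl σ₁ σ₂ ρ₁ ρ₂ ε) aux₂ σ₁≡-1 ε≡-1))
        [σ₃+σ₂][ρ₃-ρ₂]≡0 : (σ₃ + σ₂) * (ρ₃ - ρ₂) ≡ 0#
        [σ₃+σ₂][ρ₃-ρ₂]≡0 = combine₂ (solve 5 (λ t s₃ u r₃ ε →
            (s₃ :+ t) :* (r₃ :- u) :- 𝟎 := 𝟏 :* auxᵖ ε t u s₃ r₃ :+ (r₃ :* t :- s₃ :* u) :* (ε :- :- 𝟏))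
          refl σ₂ σ₃ ρ₂ ρ₃ ε) aux₃ ε≡-1
        ρ₃≢ρ₂ : ρ₃ ≢ ρ₂
        ρ₃≢ρ₂ ρ₃≡ρ₂ = *-≢0 (0<⇒≢0 0<k) (*-≢0 ρ₁≢0 (-≢0 (ρ₁≢1 ∘ sym))) (combine₄ (solve 8 (λ a b c₂ a₂ b₂ r u r₃ →
            kᵖ a b :* (r :* (𝟏 :- r)) :- 𝟎
              := 𝟏 :* at₂ᵖ (kᵖ a b) c₂ a₂ b₂ r u r₃ :+ r :* (kᵖ a b :- (c₂ :+ a₂ :+ b₂))
                 :+ (:- (a₂ :+ b₂ :- kᵖ a b :* r)) :* (u :- r) :+ (:- b₂) :* (r₃ :- u))
          refl a₁ b₁ c₂ a₂ b₂ ρ₁ ρ₂ ρ₃) (at₂ ρ-rec) k≡c₂+a₂+b₂ ρ₂≡ρ₁ ρ₃≡ρ₂)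
          where
          0<k : 0# < k
          0<k = +-pos 0<1 (+-pos 0<a₁ 0<b₁)
        σ₃+σ₂≢0 : σ₃ + σ₂ ≢ 0#
        σ₃+σ₂≢0 σ₃+σ₂≡0 = 0<⇒≢0 0<X X≡0
          where
          X : Carrier
          X = (a₁ + a₁) * (c₂ + (a₂ + a₂)) + (a₂ + a₂) * b₁
          0<X : 0# < X
          0<X = +-pos (*-pos (+-pos 0<a₁ 0<a₁) (+-pos 0<c₂ (+-pos 0<a₂ 0<a₂))) (*-pos (+-pos 0<a₂ 0<a₂) 0<b₁)
          b₁[σ₂-1]≡a₁+a₁ : b₁ * (σ₂ - 1#) ≡ a₁ + a₁
          b₁[σ₂-1]≡a₁+a₁ = combine₂ (solve 4 (λ a b s t →
              b :* (t :- 𝟏) :- (a :+ a)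
                := 𝟏 :* at₁ᵖ a b s t :+ (:- 𝟏 :- (a :+ a) :+ a :* s :- b :+ b :* s :+ s) :* (s :- :- 𝟏))
            refl a₁ b₁ σ₁ σ₂) (at₁ σ-rec) σ₁≡-1
          [c₂+2a₂]σ₂≡c₂ : (c₂ + (a₂ + a₂)) * σ₂ ≡ c₂
          [c₂+2a₂]σ₂≡c₂ = combine₄ (solve 8 (λ a b c₂ a₂ b₂ s t s₃ →
              (c₂ :+ (a₂ :+ a₂)) :* t :- c₂
                := 𝟏 :* at₂ᵖ (kᵖ a b) c₂ a₂ b₂ s t s₃ :+ (a :* t :+ b :* t :- c₂ :+ t) :* (s :- :- 𝟏)
                   :+ (:- b₂) :* (s₃ :+ t :- 𝟎) :+ (:- t) :* (kᵖ a b :- (c₂ :+ a₂ :+ b₂)))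
            refl a₁ b₁ c₂ a₂ b₂ σ₁ σ₂ σ₃) (at₂ σ-rec) σ₁≡-1 σ₃+σ₂≡0 k≡c₂+a₂+b₂
          X≡0 : X ≡ 0#
          X≡0 = combine₂ (solve 5 (λ a b c₂ a₂ t →
              (a :+ a) :* (c₂ :+ (a₂ :+ a₂)) :+ (a₂ :+ a₂) :* b :- 𝟎
                := (:- (c₂ :+ (a₂ :+ a₂))) :* (b :* (t :- 𝟏) :- (a :+ a)) :+ b :* ((c₂ :+ (a₂ :+ a₂)) :* t :- c₂))
            refl a₁ b₁ c₂ a₂ σ₂) b₁[σ₂-1]≡a₁+a₁ [c₂+2a₂]σ₂≡c₂

      1-εσ₁≢0 : 1# - ε * σ₁ ≢ 0#
      1-εσ₁≢0 1-εσ₁≡0 = *-≢0 ρ₁≢0 (-≢0 σ₁≢ε) (combine₂ (solve 3 (λ s r ε →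
          r :* (s :- ε) :- 𝟎 := 𝟏 :* (s :* r :- 𝟏 :- ε :* (r :- s)) :+ 𝟏 :* (𝟏 :- ε :* s :- 𝟎))
        refl σ₁ ρ₁ ε) aux₁ 1-εσ₁≡0)

      [σ₁²-σ₂][1-εσ₁]≢0 : (σ₁ * σ₁ - σ₂) * (1# - ε * σ₁) ≢ 0#
      [σ₁²-σ₂][1-εσ₁]≢0 = *-≢0 (-≢0 σ₁²≢σ₂) 1-εσ₁≢0

      k-identity : k * ((σ₁ * σ₁ - σ₂) * (1# - ε * σ₁)) ≡ (σ₂ - 1#) * (σ₁ - ε)
      k-identity = combine₂ (solve 6 (λ a b s t r ε →
          kᵖ a b :* ((s :* s :- t) :* (𝟏 :- ε :* s)) :- (t :- 𝟏) :* (s :- ε)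
            := (:- (kᵖ a b :* (s :* s :- t))) :* (s :* r :- 𝟏 :- ε :* (r :- s))
               :+ (s :- ε) :* (kᵖ a b :* r :* (s :* s :- t) :- (t :- 𝟏)))
        refl a₁ b₁ σ₁ σ₂ ρ₁ ε) aux₁ ρ₁-relation

      k-formula : k ≡ ((1# - σ₁) * (1# - σ₂)) / ((σ₁ * σ₁ - σ₂) * (1# - ε * σ₁)) * ((σ₁ - ε) / (σ₁ - 1#))
      k-formula = *≡*⇒≡/*/ [σ₁²-σ₂][1-εσ₁]≢0 (-≢0 σ₁≢1) (combine₁ (solve 5 (λ a b s t ε →
          let M = (s :* s :- t) :* (𝟏 :- ε :* s) in
          (𝟏 :- s) :* (𝟏 :- t) :* (s :- ε) :- kᵖ a b :* (M :* (s :- 𝟏))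
            := (:- (s :- 𝟏)) :* (kᵖ a b :* M :- (t :- 𝟏) :* (s :- ε)))
        refl a₁ b₁ σ₁ σ₂ ε) k-identity)

module Counting where
  open import Data.Nat using (_+_; _<_; _⊓_; _≡ᵇ_)

  indicator : Bool → ℕ
  indicator b = if b then 1 else 0

  module _ {A : Set} where
    countᵇ : (A → Bool) → List A → ℕ
    countᵇ f xs = sum (map (indicator ∘ f) xs)

    countᵇ-≢0 : ∀ {f xs} → Any (T ∘ f) xs → countᵇ f xs ≢ 0
    countᵇ-≢0 {f} {x ∷ xs} (here fx) with f x
    ... | true = λ ()
    countᵇ-≢0 {f} {x ∷ xs} (there any) with f x
    ... | true = λ ()
    ... | false = countᵇ-≢0 any

    countᵇ-witness : ∀ {f} xs → countᵇ f xs ≢ 0 → ∃ λ x → T (f x)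
    countᵇ-witness [] c≢0 = ⊥-elim (c≢0 refl)
    countᵇ-witness {f} (x ∷ xs) c≢0 with f x in fx
    ... | true = x , subst T (sym fx) _
    ... | false = countᵇ-witness xs c≢0

    countᵇ-≡0 : ∀ {f} xs → (∀ x → ¬ T (f x)) → countᵇ f xs ≡ 0
    countᵇ-≡0 [] _ = refl
    countᵇ-≡0 {f} (x ∷ xs) ¬f with f x in fx
    ... | true = ⊥-elim (¬f x (subst T (sym fx) _))
    ... | false = countᵇ-≡0 xs ¬f

    countᵇ-+₃ : ∀ {f g h e} xs → (∀ x → indicator (f x) + indicator (g x) + indicator (h x) ≡ indicator (e x)) →
               countᵇ f xs + countᵇ g xs + countᵇ h xs ≡ countᵇ e xs
    countᵇ-+₃ [] _ = refl
    countᵇ-+₃ {f} {g} {h} {e} (x ∷ xs) pointwise = begin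
      (fx + Cf) + (gx + Cg) + (hx + Ch)   ≡⟨ solve 6 (λ fx gx hx Cf Cg Ch →
                                                (fx :+ Cf) :+ (gx :+ Cg) :+ (hx :+ Ch) := (fx :+ gx :+ hx) :+ (Cf :+ Cg :+ Ch))
                                              refl fx gx hx Cf Cg Ch ⟩
      (fx + gx + hx) + (Cf + Cg + Ch)     ≡⟨ cong₂ _+_ (pointwise x) (countᵇ-+₃ xs pointwise) ⟩
      indicator (e x) + countᵇ e xs        ∎
      where
      open ≡-Reasoning
      open import Data.Nat.Solver using (module +-*-Solver)
      open +-*-Solver
      fx gx hx Cf Cg Ch : ℕ
      fx = indicator (f x) ; gx = indicator (g x) ; hx = indicator (h x)
      Cf = countᵇ f xs ; Cg = countᵇ g xs ; Ch = countᵇ h xs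

  countᵇ-tabulate-suc : ∀ {n} (f : Fin (suc n) → Bool) → countᵇ f (tabulate fsuc) ≡ countᵇ (f ∘ fsuc) (allFin n)
  countᵇ-tabulate-suc {n} f =
    cong sum (trans (map-tabulate (fsuc {n}) (indicator ∘ f)) (sym (map-tabulate (id {A = Fin n}) (indicator ∘ f ∘ fsuc))))

  countᵇ-allFin-unique : ∀ {n} (f : Fin n → Bool) {y} → T (f y) → (∀ w → T (f w) → w ≡ y) → countᵇ f (allFin n) ≡ 1
  countᵇ-allFin-unique {suc n} f {fzero} fy unique with f fzero
  ... | true = cong suc (trans (countᵇ-tabulate-suc f) (countᵇ-≡0 (allFin n) (λ w fw → case unique (fsuc w) fw of λ ())))
  countᵇ-allFin-unique {suc n} f {fsuc y} fy unique with f fzero in f0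
  ... | true = case unique fzero (subst T (sym f0) _) of λ ()
  ... | false =
    trans (countᵇ-tabulate-suc f) (countᵇ-allFin-unique (f ∘ fsuc) fy (λ w fw → Fin.suc-injective (unique (fsuc w) fw)))

  sum-applyUpTo-threshold : ∀ (h : ℕ → ℕ) d m → (∀ {j} → j < d → h j ≡ 1) → (∀ {j} → d ≤ j → h j ≡ 0) →
                            sum (applyUpTo h m) ≡ d ⊓ m
  sum-applyUpTo-threshold h d zero _ _ = sym (ℕ.⊓-zeroʳ d)
  sum-applyUpTo-threshold h zero (suc m) _ above rewrite above {0} z≤n =
    sum-applyUpTo-threshold (h ∘ suc) zero m (λ ()) (λ _ → above z≤n)
  sum-applyUpTo-threshold h (suc d) (suc m) below above rewrite below {0} (s≤s z≤n) =
    cong suc (sum-applyUpTo-threshold (h ∘ suc) d m (below ∘ s≤s) (above ∘ s≤s))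

  indicator-window : ∀ h m → h ≤ m → m ≤ suc (suc h) →
                     indicator (m ≡ᵇ h) + indicator (m ≡ᵇ suc h) + indicator (m ≡ᵇ suc (suc h)) ≡ 1
  indicator-window zero zero _ _ = refl
  indicator-window zero (suc zero) _ _ = refl
  indicator-window zero (suc (suc zero)) _ _ = refl
  indicator-window zero (suc (suc (suc m))) _ (s≤s (s≤s ()))
  indicator-window (suc h) (suc m) (s≤s h≤m) (s≤s m≤h+2) = indicator-window h m h≤m m≤h+2

open Counting

module Walks (Γ : Graph) where
  open Graph Γ using (n; adj; loopless)
  open import Data.Nat using (_<_; _≤′_; ≤′-refl; ≤′-step; _⊓_)
  open Equivalence

  Adjacent : Fin n → Fin n → Set
  Adjacent x y = T (adj x y)

  adjacent-sym : ∀ {x y} → Adjacent x y → Adjacent y x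
  adjacent-sym {x} {y} = subst T (Graph.sym Γ x y)

  record Walk (m : ℕ) (x y : Fin n) : Set where
    constructor walk
    field
      T-within : T (within Γ m x y)
  open Walk

  walk₀⇒≡ : ∀ {x y} → Walk 0 x y → x ≡ y
  walk₀⇒≡ = toWitness ∘ T-within

  walk₀ : ∀ x → Walk 0 x x
  walk₀ x = walk (fromWitness refl)

  walk-suc : ∀ {m x y} → Walk m x y → Walk (suc m) x y
  walk-suc (walk w) = walk (from T-∨ (inj₁ w))

  walk-mono : ∀ {m m′ x y} → m ≤ m′ → Walk m x y → Walk m′ x y
  walk-mono {m} {x = x} {y} m≤m′ w = go (ℕ.≤⇒≤′ m≤m′)
    where
    go : ∀ {m′} → m ≤′ m′ → Walk m′ x y
    go ≤′-refl = w
    go (≤′-step m≤m′) = walk-suc (go m≤m′)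

  walk-step : ∀ {m x a b} → Walk m x a → Adjacent a b → Walk (suc m) x b
  walk-step {m} {x} {a} {b} (walk w) a~b =
    walk (from T-∨ (inj₂ (any⁺ (λ z → within Γ m x z ∧ adj z b) (tabulate⁺ a (from T-∧ (w , a~b))))))

  walk-suc⁻ : ∀ {m x y} → Walk (suc m) x y → Walk m x y ⊎ ∃ λ z → Walk m x z × Adjacent z y
  walk-suc⁻ {m} {x} {y} (walk w) with to T-∨ w
  ... | inj₁ w′ = inj₁ (walk w′)
  ... | inj₂ w′ with satisfied (any⁻ (λ z → within Γ m x z ∧ adj z y) (vertices Γ) w′)
  ...   | z , wz = inj₂ (z , walk (proj₁ (to T-∧ wz)) , proj₂ (to T-∧ wz))

  walk-prepend : ∀ {m x a y} → Adjacent x a → Walk m a y → Walk (suc m) x y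
  walk-prepend {zero} {x} x~a w with walk₀⇒≡ w
  ... | refl = walk-step (walk₀ x) x~a
  walk-prepend {suc m} x~a w with walk-suc⁻ w
  ... | inj₁ w′ = walk-suc (walk-prepend x~a w′)
  ... | inj₂ (z , w′ , z~y) = walk-step (walk-prepend x~a w′) z~y

  walk-sym : ∀ {m x y} → Walk m x y → Walk m y x
  walk-sym {zero} w with walk₀⇒≡ w
  ... | refl = w
  walk-sym {suc m} w with walk-suc⁻ w
  ... | inj₁ w′ = walk-suc (walk-sym w′)
  ... | inj₂ (z , w′ , z~y) = walk-prepend (adjacent-sym z~y) (walk-sym w′)

  AtDistance : ℕ → Fin n → Fin n → Set
  AtDistance m x y = Walk m x y × (∀ j → Walk j x y → m ≤ j)

  atDistance-unique : ∀ {m m′ x y} → AtDistance m x y → AtDistance m′ x y → m ≡ m′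
  atDistance-unique (w , shortest) (w′ , shortest′) = ℕ.≤-antisym (shortest _ w′) (shortest′ _ w)

  atDistance-sym : ∀ {m x y} → AtDistance m x y → AtDistance m y x
  atDistance-sym (w , shortest) = walk-sym w , λ j → shortest j ∘ walk-sym

  atDistance₀ : ∀ x → AtDistance 0 x x
  atDistance₀ x = walk₀ x , λ _ _ → z≤n

  walk⇒atDistance : ∀ {m x y} → Walk m x y → ∃ λ d → AtDistance d x y × d ≤ m
  walk⇒atDistance {zero} w = 0 , (w , λ _ _ → z≤n) , z≤n
  walk⇒atDistance {suc m} {x} {y} w with within Γ m x y in shorter
  ... | true = let d , at , d≤m = walk⇒atDistance (walk (subst T (sym shorter) _)) in d , at , ℕ.m≤n⇒m≤1+n d≤m
  ... | false = suc m , (w , shortest) , ℕ.≤-refl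
    where
    shortest : ∀ j → Walk j x y → suc m ≤ j
    shortest j wj with j ℕ.≤? m
    ... | yes j≤m = case subst T shorter (T-within (walk-mono j≤m wj)) of λ ()
    ... | no j≰m = ℕ.≰⇒> j≰m

  adjacent⇒atDistance₁ : ∀ {x y} → Adjacent x y → AtDistance 1 x y
  adjacent⇒atDistance₁ {x} {y} x~y = walk-step (walk₀ x) x~y , shortest
    where
    shortest : ∀ j → Walk j x y → 1 ≤ j
    shortest zero w with walk₀⇒≡ w
    ... | refl = case subst T (loopless x) x~y of λ ()
    shortest (suc j) _ = s≤s z≤n

  atDistance₁⇒adjacent : ∀ {x y} → AtDistance 1 x y → Adjacent x y
  atDistance₁⇒adjacent (w , shortest) with walk-suc⁻ w
  ... | inj₁ w₀ = case shortest 0 w₀ of λ ()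
  ... | inj₂ (z , w₀ , z~y) with walk₀⇒≡ w₀
  ...   | refl = z~y

  atDistance-adjacent : ∀ {m m′ x a b} → AtDistance m x a → Adjacent a b → AtDistance m′ x b → m ≤ suc m′
  atDistance-adjacent (_ , shortest) a~b (wb , _) = shortest _ (walk-step wb (adjacent-sym a~b))

  predecessor : ∀ {h x y} → AtDistance (suc h) x y → ∃ λ z → AtDistance h x z × Adjacent z y
  predecessor {h} {x} {y} (w , shortest) with walk-suc⁻ w
  ... | inj₁ w′ = ⊥-elim (ℕ.<-irrefl refl (shortest h w′))
  ... | inj₂ (z , wz , z~y) = z , (wz , λ j wj → ℕ.≤-pred (shortest (suc j) (walk-step wj z~y))) , z~y

  descend : ∀ {m x y} k → k ≤ m → AtDistance m x y → ∃ λ y′ → AtDistance k x y′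
  descend k k≤m at with ℕ.m≤n⇒m<n∨m≡n k≤m
  ... | inj₂ refl = _ , at
  ... | inj₁ (s≤s k≤m-1) = descend k k≤m-1 (proj₁ (proj₂ (predecessor at)))

  dist-atDistance : ∀ {d x y} → AtDistance d x y → dist Γ x y ≡ d ⊓ n
  dist-atDistance {d} {x} {y} (w , shortest) =
    trans (cong sum (map-applyUpTo id _ n)) (sum-applyUpTo-threshold _ d n below above)
    where
    below : ∀ {j} → j < d → (if within Γ j x y then 0 else 1) ≡ 1
    below {j} j<d with within Γ j x y in wj
    ... | true = ⊥-elim (ℕ.<⇒≱ j<d (shortest j (walk (subst T (sym wj) _))))
    ... | false = refl
    above : ∀ {j} → d ≤ j → (if within Γ j x y then 0 else 1) ≡ 0
    above {j} d≤j with within Γ j x y | T-within (walk-mono {m′ = j} d≤j w)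
    ... | true | _ = refl

  dist≡ : ∀ {d x y} → AtDistance d x y → d ≤ n → dist Γ x y ≡ d
  dist≡ at d≤n = trans (dist-atDistance at) (ℕ.m≤n⇒m⊓n≡m d≤n)

  connected⇒atDistance : Connected Γ → ∀ x y → ∃ λ d → AtDistance d x y
  connected⇒atDistance connected x y with connected x y
  ... | m , w = let d , at , _ = walk⇒atDistance {m} (walk (subst T (sym w) _)) in d , at

  dist⇒atDistance : Connected Γ → ∀ {d x y} → dist Γ x y ≡ d → d < n → AtDistance d x y
  dist⇒atDistance connected {d} {x} {y} dist≡d d<n with connected⇒atDistance connected x y
  ... | d′ , at with ℕ.≤-total d′ n
  ...   | inj₁ d′≤n = subst (λ e → AtDistance e x y) (trans (sym (dist≡ at d′≤n)) dist≡d) at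
  ...   | inj₂ n≤d′ = ⊥-elim (ℕ.<-irrefl (trans (sym dist≡d) (trans (dist-atDistance at) (ℕ.m≥n⇒m⊓n≡n n≤d′))) d<n)

  walk⇒atDistance-≥ : ∀ {m x y} → Walk m x y → (∀ {d} → AtDistance d x y → m ≤ d) → AtDistance m x y
  walk⇒atDistance-≥ w lower with walk⇒atDistance w
  ... | d , at , d≤m with ℕ.≤-antisym d≤m (lower at)
  ...   | refl = at

module _ (p : ℕ → ℕ → ℕ → ℕ) where
  open Params p
  open import Data.Nat using (_+_)

  record LowIntersectionNumbers : Set where
    field
      a₀≡0 : aₙ 0 ≡ 0
      c₁≡1 : cₙ 1 ≡ 1
      c₁+a₁+b₁≡k : cₙ 1 + aₙ 1 + bₙ 1 ≡ kₙ
      c₂+a₂+b₂≡k : cₙ 2 + aₙ 2 + bₙ 2 ≡ kₙ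
      b₁≢0 : bₙ 1 ≢ 0
      c₂≢0 : cₙ 2 ≢ 0
      a₂≢0 : aₙ 2 ≢ 0
      b₂≢0 : bₙ 2 ≢ 0

module DistanceRegular (Γ : Graph) (D : ℕ) (p : ℕ → ℕ → ℕ → ℕ) (connected : Connected Γ) (diameter : IsDiameter Γ D)
                       (intersection : IsIntersectionArray Γ D p) (3≤D : 3 ≤ D) where
  open Graph Γ using (n)
  open Walks Γ
  open Params p
  open Equivalence
  open import Data.Nat using (_+_; _≡ᵇ_; _≤ᵇ_; _⊓_)

  record Geodesic₃ : Set where
    field
      x y z v : Fin n
      x~y : Adjacent x y
      y~z : Adjacent y z
      z~v : Adjacent z v
      x-z : AtDistance 2 x z
      x-v : AtDistance 3 x v

  distant-pair : ∃ λ m → ∃ λ x → ∃ λ y → AtDistance m x y × 3 ≤ m ⊓ n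
  distant-pair with proj₂ diameter
  ... | x , y , dist≡D with connected⇒atDistance connected x y
  ...   | m , at = m , x , y , at , subst (3 ≤_) (trans (sym dist≡D) (dist-atDistance at)) 3≤D

  3≤n : 3 ≤ n
  3≤n with distant-pair
  ... | m , _ , _ , _ , 3≤m⊓n = ℕ.≤-trans 3≤m⊓n (ℕ.m⊓n≤n m n)

  geodesic₃ : Geodesic₃
  geodesic₃ with distant-pair
  ... | m , x , _ , at , 3≤m⊓n with descend 3 (ℕ.≤-trans 3≤m⊓n (ℕ.m⊓n≤m m n)) at
  ...   | v , x-v with predecessor x-v
  ...     | z , x-z , z~v with predecessor x-z
  ...       | y , x-y , y~z = record
    { x = x ; y = y ; z = z ; v = v ; x~y = atDistance₁⇒adjacent x-y ; y~z = y~z ; z~v = z~v ; x-z = x-z ; x-v = x-v }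

  ≤3 : ∀ i → {T (i ≤ᵇ 3)} → i ≤ 3
  ≤3 i {i≤3} = ℕ.≤ᵇ⇒≤ i 3 i≤3

  dist-small : ∀ {d X Y} → AtDistance d X Y → d ≤ 3 → dist Γ X Y ≡ d
  dist-small at d≤3 = dist≡ at (ℕ.≤-trans d≤3 3≤n)

  adjacent⇐dist₁ : ∀ {X Y} → dist Γ X Y ≡ 1 → Adjacent X Y
  adjacent⇐dist₁ d≡1 = atDistance₁⇒adjacent (dist⇒atDistance connected d≡1 (ℕ.≤-trans (≤3 2) 3≤n))

  InSpheres : Fin n → ℕ → Fin n → ℕ → Fin n → Bool
  InSpheres X i Y j w = (dist Γ X w ≡ᵇ i) ∧ (dist Γ Y w ≡ᵇ j)

  inSpheres⁺ : ∀ {X i Y j w} → dist Γ X w ≡ i → dist Γ Y w ≡ j → T (InSpheres X i Y j w)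
  inSpheres⁺ X-w Y-w = from T-∧ (≡⇒≡ᵇ _ _ X-w , ≡⇒≡ᵇ _ _ Y-w)

  inSpheres⁻ : ∀ X i Y j {w} → T (InSpheres X i Y j w) → dist Γ X w ≡ i × dist Γ Y w ≡ j
  inSpheres⁻ X i Y j {w} w∈ = ≡ᵇ⇒≡ (dist Γ X w) i (proj₁ (to T-∧ w∈)) , ≡ᵇ⇒≡ (dist Γ Y w) j (proj₂ (to T-∧ w∈))

  count-spheres : ∀ {h X Y i j} → dist Γ X Y ≡ h → i ≤ 3 → j ≤ 3 → countᵇ (InSpheres X i Y j) (vertices Γ) ≡ p h i j
  count-spheres {X = X} {Y} {i} {j} d≡h i≤3 j≤3 =
    trans (intersection X Y i j (ℕ.≤-trans i≤3 3≤D) (ℕ.≤-trans j≤3 3≤D)) (cong (λ h → p h i j) d≡h)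

  p≢0 : ∀ {h i j X Y} w → AtDistance h X Y → AtDistance i X w → AtDistance j Y w → h ≤ 3 → i ≤ 3 → j ≤ 3 → p h i j ≢ 0
  p≢0 w X-Y X-w Y-w h≤3 i≤3 j≤3 = subst (_≢ 0) (count-spheres (dist-small X-Y h≤3) i≤3 j≤3)
    (countᵇ-≢0 (tabulate⁺ w (inSpheres⁺ (dist-small X-w i≤3) (dist-small Y-w j≤3))))

  neighbours-split : ∀ {h X Y} → AtDistance (suc h) X Y → h ≤ 1 →
                     p (suc h) 1 h + p (suc h) 1 (suc h) + p (suc h) 1 (suc (suc h)) ≡ p 0 1 1
  neighbours-split {h} {X} {Y} X-Y h≤1 = begin
    p (suc h) 1 h + p (suc h) 1 (suc h) + p (suc h) 1 (suc (suc h))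
      ≡⟨ cong₂ _+_ (cong₂ _+_ (count-spheres d (≤3 1) h≤3) (count-spheres d (≤3 1) h+1≤3)) (count-spheres d (≤3 1) h+2≤3) ⟨
    countᵇ (InSpheres X 1 Y h) V + countᵇ (InSpheres X 1 Y (suc h)) V + countᵇ (InSpheres X 1 Y (suc (suc h))) V
      ≡⟨ countᵇ-+₃ V pointwise ⟩
    countᵇ (InSpheres X 1 X 1) V
      ≡⟨ count-spheres (dist-small (atDistance₀ X) z≤n) (≤3 1) (≤3 1) ⟩
    p 0 1 1 ∎
    where
    open ≡-Reasoning
    V : List (Fin n)
    V = vertices Γ
    h≤3 : h ≤ 3
    h≤3 = ℕ.≤-trans h≤1 (≤3 1)
    h+1≤3 : suc h ≤ 3
    h+1≤3 = ℕ.m≤n⇒m≤1+n (s≤s h≤1)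
    h+2≤3 : suc (suc h) ≤ 3
    h+2≤3 = s≤s (s≤s h≤1)
    d : dist Γ X Y ≡ suc h
    d = dist-small X-Y h+1≤3
    pointwise : ∀ w → indicator (InSpheres X 1 Y h w) + indicator (InSpheres X 1 Y (suc h) w)
                      + indicator (InSpheres X 1 Y (suc (suc h)) w) ≡ indicator (InSpheres X 1 X 1 w)
    pointwise w with dist Γ X w ≡ᵇ 1 in X-w
    ... | false = refl
    ... | true = neighbour-window (adjacent⇐dist₁ (≡ᵇ⇒≡ _ 1 (subst T (sym X-w) _)))
      where
      neighbour-window : Adjacent X w → indicator (dist Γ Y w ≡ᵇ h) + indicator (dist Γ Y w ≡ᵇ suc h)
                                        + indicator (dist Γ Y w ≡ᵇ suc (suc h)) ≡ 1
      neighbour-window X~w with walk⇒atDistance (walk-step (proj₁ (atDistance-sym X-Y)) X~w)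
      ... | m , Y-w , m≤h+2 rewrite dist-small Y-w (ℕ.≤-trans m≤h+2 h+2≤3) =
        indicator-window h m (ℕ.≤-pred (atDistance-adjacent (atDistance-sym X-Y) X~w Y-w)) m≤h+2

  module OnGeodesic (g : Geodesic₃) where
    open Geodesic₃ g

    x-y : AtDistance 1 x y
    x-y = adjacent⇒atDistance₁ x~y

    y-z : AtDistance 1 y z
    y-z = adjacent⇒atDistance₁ y~z

    common-neighbour : aₙ 1 ≢ 0 → ∃ λ w → Adjacent y w × Adjacent z w
    common-neighbour a₁≢0
      with countᵇ-witness (vertices Γ) (a₁≢0 ∘ trans (sym (count-spheres (dist-small y-z (≤3 1)) (≤3 1) (≤3 1))))
    ... | w , w∈ = let y-w , z-w = inSpheres⁻ y 1 z 1 w∈ in w , adjacent⇐dist₁ y-w , adjacent⇐dist₁ z-w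

    beyond-x : ∀ {a} → Adjacent x a → Adjacent z a → AtDistance 2 v a
    beyond-x x~a z~a = walk⇒atDistance-≥ (walk-step (walk-step (walk₀ v) (adjacent-sym z~v)) z~a)
                                          (ℕ.≤-pred ∘ atDistance-adjacent (atDistance-sym x-v) x~a)

    -- w lies at distance 1 or 2 from x; then y, v (resp. z, x) are at distance 2, and w is adjacent to the
    -- first and at distance 2 from the second.
    a₂≢0-by-distance : ∀ {w} → Adjacent y w → Adjacent z w → (∃ λ m → AtDistance m x w × m ≤ 2) → aₙ 2 ≢ 0
    a₂≢0-by-distance _ z~w (zero , x-w , _) with walk₀⇒≡ (proj₁ x-w)
    ... | refl = case atDistance-unique x-z (atDistance-sym (adjacent⇒atDistance₁ z~w)) of λ ()
    a₂≢0-by-distance {w} y~w z~w (suc zero , x-w , _) =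
      p≢0 w (atDistance-sym (beyond-x x~y (adjacent-sym y~z))) (adjacent⇒atDistance₁ y~w)
            (beyond-x (atDistance₁⇒adjacent x-w) z~w) (≤3 2) (≤3 1) (≤3 2)
    a₂≢0-by-distance {w} _ z~w (suc (suc zero) , x-w , _) =
      p≢0 w (atDistance-sym x-z) (adjacent⇒atDistance₁ z~w) x-w (≤3 2) (≤3 1) (≤3 2)
    a₂≢0-by-distance _ _ (suc (suc (suc _)) , _ , s≤s (s≤s ()))

    a₂≢0 : aₙ 1 ≢ 0 → aₙ 2 ≢ 0
    a₂≢0 a₁≢0 = let _ , y~w , z~w = common-neighbour a₁≢0 in
      a₂≢0-by-distance y~w z~w (walk⇒atDistance (walk-step (proj₁ x-y) y~w))

    a₀≡0 : aₙ 0 ≡ 0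
    a₀≡0 = trans (sym (count-spheres (dist-small (atDistance₀ x) z≤n) (≤3 1) (≤3 0)))
                 (countᵇ-≡0 (vertices Γ) λ w w∈ → let x-w≡1 , x-w≡0 = inSpheres⁻ x 1 x 0 w∈ in
                   case trans (sym x-w≡1) x-w≡0 of λ ())

    c₁≡1 : cₙ 1 ≡ 1
    c₁≡1 = trans (sym (count-spheres (dist-small x-y (≤3 1)) (≤3 1) (≤3 0)))
                 (countᵇ-allFin-unique (InSpheres x 1 y 0) y∈ only-y)
      where
      y∈ : T (InSpheres x 1 y 0 y)
      y∈ = inSpheres⁺ (dist-small x-y (≤3 1)) (dist-small (atDistance₀ y) z≤n)
      only-y : ∀ w → T (InSpheres x 1 y 0 w) → w ≡ y
      only-y w w∈ =
        sym (walk₀⇒≡ (proj₁ (dist⇒atDistance connected (proj₂ (inSpheres⁻ x 1 y 0 w∈)) (ℕ.≤-trans (≤3 1) 3≤n))))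

    low-intersection-numbers : aₙ 1 ≢ 0 → LowIntersectionNumbers p
    low-intersection-numbers a₁≢0 = record
      { a₀≡0 = a₀≡0
      ; c₁≡1 = c₁≡1
      ; c₁+a₁+b₁≡k = neighbours-split x-y z≤n
      ; c₂+a₂+b₂≡k = neighbours-split x-z ℕ.≤-refl
      ; b₁≢0 = p≢0 z (atDistance-sym x-y) y-z x-z (≤3 1) (≤3 1) (≤3 2)
      ; c₂≢0 = p≢0 y x-z x-y (adjacent⇒atDistance₁ (adjacent-sym y~z)) (≤3 2) (≤3 1) (≤3 1)
      ; a₂≢0 = a₂≢0 a₁≢0
      ; b₂≢0 = p≢0 v (atDistance-sym x-z) (adjacent⇒atDistance₁ z~v) x-v (≤3 2) (≤3 1) (≤3 3)
      }

  low-intersection-numbers : aₙ 1 ≢ 0 → LowIntersectionNumbers p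
  low-intersection-numbers = OnGeodesic.low-intersection-numbers geodesic₃

module PseudoCosineRecurrence (R : RealField) (D : ℕ) (p : ℕ → ℕ → ℕ → ℕ) (3≤D : 3 ≤ D)
                              (L : LowIntersectionNumbers p) (a₁≢0 : Params.aₙ p 1 ≢ 0) where
  open RealField R hiding (_≤_)
  open RealFieldProperties R
  open TightPairs R
  open PCS R D p
  open Params p
  open LowIntersectionNumbers L
  open ≡-Reasoning

  fromℕk≡1+a₁+b₁ : fromℕ kₙ ≡ 1# + (fromℕ (aₙ 1) + fromℕ (bₙ 1))
  fromℕk≡1+a₁+b₁ = begin
    fromℕ kₙ                                 ≡⟨ cong fromℕ (trans (sym c₁+a₁+b₁≡k) (cong (λ c → c ℕ.+ aₙ 1 ℕ.+ bₙ 1) c₁≡1)) ⟩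
    fromℕ (1 ℕ.+ aₙ 1 ℕ.+ bₙ 1)              ≡⟨ cong (1# +_) (fromℕ-+ (aₙ 1) (bₙ 1)) ⟩
    1# + (fromℕ (aₙ 1) + fromℕ (bₙ 1))       ∎

  parameters : Parameters
  parameters = record
    { a₁ = fromℕ (aₙ 1) ; b₁ = fromℕ (bₙ 1) ; c₂ = fromℕ (cₙ 2) ; a₂ = fromℕ (aₙ 2) ; b₂ = fromℕ (bₙ 2)
    ; 0<a₁ = 0<fromℕ a₁≢0 ; 0<b₁ = 0<fromℕ b₁≢0 ; 0<c₂ = 0<fromℕ c₂≢0 ; 0<a₂ = 0<fromℕ a₂≢0 ; 0<b₂ = 0<fromℕ b₂≢0
    ; k≡c₂+a₂+b₂ = begin
        1# + (fromℕ (aₙ 1) + fromℕ (bₙ 1))           ≡⟨ fromℕk≡1+a₁+b₁ ⟨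
        fromℕ kₙ                                     ≡⟨ cong fromℕ (sym c₂+a₂+b₂≡k) ⟩
        fromℕ (cₙ 2 ℕ.+ aₙ 2 ℕ.+ bₙ 2)               ≡⟨ fromℕ-+ (cₙ 2 ℕ.+ aₙ 2) (bₙ 2) ⟩
        fromℕ (cₙ 2 ℕ.+ aₙ 2) + fromℕ (bₙ 2)         ≡⟨ cong (_+ fromℕ (bₙ 2)) (fromℕ-+ (cₙ 2) (aₙ 2)) ⟩
        fromℕ (cₙ 2) + fromℕ (aₙ 2) + fromℕ (bₙ 2)   ∎
    }
  open Parameters parameters using (k)

  1≤D : 1 ≤ D
  1≤D = ℕ.≤-trans (s≤s z≤n) 3≤D

  2≤D : 2 ≤ D
  2≤D = ℕ.≤-trans (s≤s (s≤s z≤n)) 3≤D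

  θ≡kφ₁ : ∀ {θ φ} → IsPseudoCosine θ φ → θ ≡ k * φ 1
  θ≡kφ₁ {θ} {φ} (φ₀≡1 , step) = begin
    θ                                                     ≡⟨ *-identityʳ θ ⟨
    θ * 1#                                                ≡⟨ cong (θ *_) φ₀≡1 ⟨
    θ * φ 0                                               ≡⟨ step 0 1≤D ⟨
    0# + fromℕ (aₙ 0) * φ 0 + fromℕ kₙ * φ 1              ≡⟨ cong (λ a → 0# + fromℕ a * φ 0 + fromℕ kₙ * φ 1) a₀≡0 ⟩
    0# + 0# * φ 0 + fromℕ kₙ * φ 1                        ≡⟨ cong (_+ fromℕ kₙ * φ 1) (trans (+-identityˡ _) (zeroˡ (φ 0))) ⟩
    0# + fromℕ kₙ * φ 1                                   ≡⟨ +-identityˡ _ ⟩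
    fromℕ kₙ * φ 1                                        ≡⟨ cong (_* φ 1) fromℕk≡1+a₁+b₁ ⟩
    k * φ 1                                               ∎

  recurrence : ∀ {θ φ} → IsPseudoCosine θ φ → Recurrence parameters φ
  recurrence {θ} {φ} pcs@(φ₀≡1 , step) = record
    { at₁ = begin
        1# + fromℕ (aₙ 1) * φ 1 + fromℕ (bₙ 1) * φ 2
          ≡⟨ cong (λ c → c + fromℕ (aₙ 1) * φ 1 + fromℕ (bₙ 1) * φ 2) c₁φ₀≡1 ⟨
        fromℕ (cₙ 1) * φ 0 + fromℕ (aₙ 1) * φ 1 + fromℕ (bₙ 1) * φ 2
          ≡⟨ step 1 2≤D ⟩
        θ * φ 1
          ≡⟨ cong (_* φ 1) (θ≡kφ₁ pcs) ⟩
        k * φ 1 * φ 1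
          ∎
    ; at₂ = trans (step 2 3≤D) (cong (_* φ 2) (θ≡kφ₁ pcs))
    }
    where
    c₁φ₀≡1 : fromℕ (cₙ 1) * φ 0 ≡ 1#
    c₁φ₀≡1 = trans (cong₂ _*_ (cong fromℕ c₁≡1) φ₀≡1) (trans (*-identityʳ _) (+-identityʳ 1#))

  φ₁≢1 : ∀ {θ φ} → IsNontrivialPCS θ φ → φ 1 ≢ 1#
  φ₁≢1 {θ} {φ} (pcs , θ≢k) φ₁≡1 = θ≢k (begin
    θ           ≡⟨ θ≡kφ₁ pcs ⟩
    k * φ 1     ≡⟨ cong (k *_) φ₁≡1 ⟩
    k * 1#      ≡⟨ *-identityʳ k ⟩
    k           ≡⟨ fromℕk≡1+a₁+b₁ ⟨
    fromℕ kₙ    ∎)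

  -- IsTight σ is used only for the nontriviality of σ: the partner ρ comes with the auxiliary parameter.
  tight-pair₃ : ∀ {σ ε} → IsTight σ → IsAuxiliaryParameter σ ε → ∃ λ ρ → TightPair₃ parameters σ ρ ε
  tight-pair₃ {σ} {ε} ((_ , σ-nontrivial) , _)
              (ρ , (_ , ρ-nontrivial) , ((_ , σ-pcs) , (_ , ρ-pcs) , (_ , σρ-pcs)) , relation) =
    ρ , record
      { σ-rec = recurrence σ-pcs
      ; ρ-rec = recurrence ρ-pcs
      ; σρ-rec = recurrence σρ-pcs
      ; σ₁≢1 = φ₁≢1 σ-nontrivial
      ; ρ₁≢1 = φ₁≢1 ρ-nontrivial
      ; aux₁ = aux₁
      ; aux₂ = relation 2 (s≤s z≤n) 2≤D
      ; aux₃ = relation 3 (s≤s z≤n) 3≤D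
      }
    where
    aux₁ : σ 1 * ρ 1 - 1# ≡ ε * (ρ 1 - σ 1)
    aux₁ = combine₁ (solve 3 (λ s r ε → s :* r :- 𝟏 :- ε :* (r :- s) := 𝟏 :* auxᵖ ε 𝟏 𝟏 s r) refl (σ 1) (ρ 1) ε)
                    (subst₂ (λ σ₀ ρ₀ → σ 1 * ρ 1 - σ₀ * ρ₀ ≡ ε * (σ₀ * ρ 1 - σ 1 * ρ₀)) (proj₁ σ-pcs) (proj₁ ρ-pcs)
                            (relation 1 ℕ.≤-refl 1≤D))

lemma13p1 : (R : RealField) (Γ : Graph) (D : ℕ) (p : ℕ → ℕ → ℕ → ℕ)
    → Connected Γ → IsDiameter Γ D → IsIntersectionArray Γ D p
    → 3 ≤ D → Params.aₙ p 1 ≢ 0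
    → (σs : ℕ → RealField.Carrier R) (ε : RealField.Carrier R)
    → PCS.IsTight R D p σs → PCS.IsAuxiliaryParameter R D p σs ε
    → let open RealField R
          σ = σs 1
          h = ((1# - σ) * (1# - σs 2)) / ((σ * σ - σs 2) * (1# - ε * σ))
      in (σ ≢ 1#)
         × ((σ * σ - σs 2) * (1# - ε * σ) ≢ 0#)
         × (fromℕ (Params.kₙ p) ≡ h * ((σ - ε) / (σ - 1#)))
lemma13p1 R Γ D p connected diameter intersection 3≤D a₁≢0 σ ε tight auxiliary =
  let _ , pair = tight-pair₃ tight auxiliary
  in TightPair₃.σ₁≢1 pair , [σ₁²-σ₂][1-εσ₁]≢0 parameters pair , trans fromℕk≡1+a₁+b₁ (k-formula parameters pair)
  where
  open TightPairs R
  open PseudoCosineRecurrence R D p 3≤D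
         (DistanceRegular.low-intersection-numbers Γ D p connected diameter intersection 3≤D a₁≢0) a₁≢0
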